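{- Let $n,s$ be integers with $s\geq 1$ and $4s\leq n+1$, and let $P(n,s)$, $V^4_{n,s}$ and $q_{n,s}$ be as in the context. If $6s<n+1$ when $n$ is odd, or $6s<n$ when $n$ is even, then $P(n,s)$ is a Delaunay polytope of $V^4_{n,s}$ with respect to the quadratic form $q_{n,s}$ (restricted to $H$).
   Context: Coordinates of $\mathbb{R}^{n+1}$ are indexed $x=(x_0,\dots,x_n)$; $(A^a;B^{b};C^{c};\dots)$ denotes the vector whose first $a$ coordinates equal $A$, next $b$ equal $B$, etc.; $e_1$ is the standard unit vector with $x_1=1$ and all other coordinates $0$. Let $H=\{x\in\mathbb{R}^{n+1}:\sum_i x_i=0\}$, $V_{n,s}=\{x\in\mathbb{Z}^{n+1}:\sum_{i=0}^n x_i=s\}$, $J(n+1,s)=\mathrm{conv}\{x\in\{0,1\}^{n+1}:\sum_i x_i=s\}$, $v_{n,s}=((\tfrac14)^{4s};0^{n+1-4s})$, $t_{n,s}=((\tfrac12)^{2s};(-\tfrac12)^{2s};0^{n+1-4s})$, $P(n,s)=\mathrm{conv}\{v,\;2v_{n,s}-v: v\text{ a vertex of }J(n+1,s)\}$, $V^2_{n,s}=V_{n,s}\cup(t_{n,s}+V_{n,s})$, and $q_{n,s}(x)=2\sum_{i=0}^{4s-1}x_i^2+\sum_{i=4s}^n x_i^2$. Define $w_{n,s}=((\tfrac14)^{2s};(-\tfrac14)^{2s};(\tfrac12)^{n+1-4s})-\tfrac{n+1-4s}{2}e_1$ if $n$ is odd, and $w_{n,s}=((\tfrac14)^{2s};(-\tfrac14)^{2s};0;(\tfrac12)^{n-4s})-\tfrac{n-4s}{2}e_1$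 if $n$ is even, and $V^4_{n,s}=V^2_{n,s}\cup(w_{n,s}+V^2_{n,s})$ (an affine lattice containing $V^2_{n,s}$ with index $2$). A polytope $D$ with vertices in $V^4_{n,s}$ is a Delaunay polytope of $V^4_{n,s}$ w.r.t. a positive definite form $Q$ on $H$ if there exist $c$ with $\sum_i c_i=s$ and $r>0$ such that $Q(v-c)=r$ for all vertices $v$ of $D$ and $Q(v-c)>r$ for all other $v\in V^4_{n,s}$. -}

module Defs where

open import Data.Nat as ℕ using (ℕ; zero; suc; _<ᵇ_; _≡ᵇ_)
open import Data.Bool using (Bool; true; false; if_then_else_)
open import Data.Fin using (Fin; toℕ)
open import Data.Integer using (+_)
open import Data.Rational using (ℚ; _+_; _*_; _-_; -_; _/_; _≤_; _<_; ↧ₙ_; 0ℚ; 1ℚ)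
open import Data.List using (List; []; _∷_)
open import Data.List.Relation.Unary.All using (All)
open import Data.Product using (Σ; _×_; _,_; proj₁; proj₂)
open import Data.Sum using (_⊎_)
open import Relation.Binary.PropositionalEquality using (_≡_)
open import Relation.Nullary using (¬_)

-- Points of ℝ^{n+1} with rational coordinates, indexed x_0,…,x_n.
Pt : ℕ → Set
Pt n = Fin (suc n) → ℚ

ℕ→ℚ : ℕ → ℚ
ℕ→ℚ k = + k / 1

sumFin : (m : ℕ) → (Fin m → ℚ) → ℚ
sumFin zero    f = 0ℚ
sumFin (suc m) f = f Fin.zero + sumFin m (λ i → f (Fin.suc i))

sumPt : (n : ℕ) → Pt n → ℚ
sumPt n x = sumFin (suc n) x

_⊕_ : {n : ℕ} → Pt n → Pt n → Pt n
(x ⊕ y) i = x i + y i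

_⊖_ : {n : ℕ} → Pt n → Pt n → Pt n
(x ⊖ y) i = x i - y i

IsInt : ℚ → Set
IsInt q = ↧ₙ q ≡ 1

isOdd : ℕ → Bool
isOdd zero = false
isOdd (suc k) = if isOdd k then false else true

¼ ½ : ℚ
¼ = + 1 / 4
½ = + 1 / 2

InV : (n s : ℕ) → Pt n → Set
InV n s x = (∀ i → IsInt (x i)) × sumPt n x ≡ ℕ→ℚ s

vns : (n s : ℕ) → Pt n
vns n s i = if toℕ i <ᵇ 4 ℕ.* s then ¼ else 0ℚ

tns : (n s : ℕ) → Pt n
tns n s i = if toℕ i <ᵇ 2 ℕ.* s then ½
            else if toℕ i <ᵇ 4 ℕ.* s then - ½ else 0ℚ

e1 : (n : ℕ) → Pt n
e1 n i = if toℕ i ≡ᵇ 1 then 1ℚ else 0ℚ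

wns : (n s : ℕ) → Pt n
wns n s i =
  if isOdd n
  then (if toℕ i <ᵇ 2 ℕ.* s then ¼
        else if toℕ i <ᵇ 4 ℕ.* s then - ¼ else ½)
       - ℕ→ℚ (suc n ℕ.∸ 4 ℕ.* s) * ½ * e1 n i
  else (if toℕ i <ᵇ 2 ℕ.* s then ¼
        else if toℕ i <ᵇ 4 ℕ.* s then - ¼
        else if toℕ i ≡ᵇ 4 ℕ.* s then 0ℚ else ½)
       - ℕ→ℚ (n ℕ.∸ 4 ℕ.* s) * ½ * e1 n i

InV2 : (n s : ℕ) → Pt n → Set
InV2 n s x = InV n s x ⊎ InV n s (x ⊖ tns n s)

InV4 : (n s : ℕ) → Pt n → Set
InV4 n s x = InV2 n s x ⊎ InV2 n s (x ⊖ wns n s)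

qns : (n s : ℕ) → Pt n → ℚ
qns n s x = sumPt n (λ i → (if toℕ i <ᵇ 4 ℕ.* s then ℕ→ℚ 2 else 1ℚ) * (x i * x i))

IsJVertex : (n s : ℕ) → Pt n → Set
IsJVertex n s x = (∀ i → x i ≡ 0ℚ ⊎ x i ≡ 1ℚ) × sumPt n x ≡ ℕ→ℚ s

-- generating set of P(n,s):  { v, 2 v_{n,s} - v : v vertex of J(n+1,s) }
-- (x = 2 v_{n,s} - v  iff  v = 2 v_{n,s} - x)
GenP : (n s : ℕ) → Pt n → Set
GenP n s x = IsJVertex n s x ⊎ IsJVertex n s (λ i → ℕ→ℚ 2 * vns n s i - x i)

InConv : {n : ℕ} → (Pt n → Set) → Pt n → Set
InConv {n} S x =
  Σ (List (ℚ × Pt n)) λ L →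
    All (λ p → (0ℚ ≤ proj₁ p) × S (proj₂ p)) L
    × sumL (λ p → proj₁ p) L ≡ 1ℚ
    × (∀ i → sumL (λ p → proj₁ p * proj₂ p i) L ≡ x i)
  where
  sumL : (ℚ × Pt n → ℚ) → List (ℚ × Pt n) → ℚ
  sumL f [] = 0ℚ
  sumL f (p ∷ ps) = f p + sumL f ps

-- vertices of P(n,s) = conv(GenP): the extreme points, i.e. the generators
-- that are not convex combinations of the other generators
IsVertexP : (n s : ℕ) → Pt n → Set
IsVertexP n s x =
  GenP n s x × ¬ InConv (λ p → GenP n s p × ¬ (∀ i → p i ≡ x i)) x

IsDelaunayV4 : (n s : ℕ) → (Pt n → Set) → (Pt n → ℚ) → Set
IsDelaunayV4 n s Vert Q =
  (∀ x → Vert x → InV4 n s x) ×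
  Σ (Pt n) λ c → Σ ℚ λ r →
    sumPt n c ≡ ℕ→ℚ s × 0ℚ < r ×
    (∀ x → Vert x → Q (x ⊖ c) ≡ r) ×
    (∀ x → InV4 n s x → ¬ Vert x → r < Q (x ⊖ c))

module Submission where

-- The centre is v_{n,s} and the (squared) radius is 3s/2. For y with Σ y = s one has
-- q(y - v) = 3s/2 + Σ qᵢ yᵢ (yᵢ - 1), and yᵢ (yᵢ - 1) ≥ 0 on integers with equality exactly on {0, 1};
-- so on V_{n,s} the form is ≥ 3s/2 with equality exactly at the vertices of J(n+1,s). The reflection
-- y ↦ 2v - y preserves q(· - v) and exchanges V_{n,s} with t_{n,s} + V_{n,s}, which accounts for the
-- reflected vertices. On the two cosets w + V²_{n,s}, each coordinate of x - v is integral or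
-- half-integral in a fixed pattern, and the half-integral ones alone give q(x - v) ≥ N/4, with N the
-- even one of n and n + 1; this exceeds 3s/2 = 6s/4 exactly under the hypothesis 6s < N. Finally,
-- a point on a sphere of a positive definite form is not a convex combination of other points of
-- that sphere, so every generator of P(n,s) is a vertex.

open import Defs
open import Data.Bool using (Bool; true; false; if_then_else_)
open import Data.Fin as Fin using (Fin; toℕ)
import Data.Fin.Properties as Fin
open import Data.Integer as ℤ using (ℤ; -[1+_])
import Data.Integer.Properties as ℤ
open import Data.List using (List; []; _∷_)
open import Data.List.Relation.Unary.All as All using (All; []; _∷_)
open import Data.Nat as ℕ using (ℕ; zero; suc; _<ᵇ_; _≡ᵇ_)
open import Data.Nat.Coprimality using (1-coprimeTo) renaming (sym to coprime-sym)
import Data.Nat.Properties as ℕ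
open import Data.Product using (Σ; _×_; _,_; proj₁; proj₂)
open import Data.Rational
  using (ℚ; mkℚ; _/_; _+_; _*_; _-_; -_; _≤_; _<_; 0ℚ; 1ℚ; *<*; positive; negative; nonNegative; nonPositive)
import Data.Rational.Properties as ℚ
open import Data.Rational.Solver using (module +-*-Solver)
open import Data.Sum using (_⊎_; inj₁; inj₂; [_,_]′)
open import Function using (_∘_; id)
open import Relation.Binary using (tri<; tri≈; tri>)
open import Relation.Binary.PropositionalEquality
open import Relation.Nullary using (¬_; Dec; contradiction; yes; no; _⊎-dec_)
open import Relation.Nullary.Reflects using (Reflects; ofʸ; ofⁿ; fromEquivalence)
open +-*-Solver

-- Integral rationals

fromℤ : ℤ → ℚ
fromℤ k = mkℚ k 0 (coprime-sym (1-coprimeTo _))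

/1≡fromℤ : ∀ k → k / 1 ≡ fromℤ k
/1≡fromℤ k = ℚ.↥p/↧p≡p (fromℤ k)

fromℤ-+ : ∀ a b → fromℤ (a ℤ.+ b) ≡ fromℤ a + fromℤ b
fromℤ-+ a b = sym (trans (/1≡fromℤ _) (cong fromℤ (cong₂ ℤ._+_ (ℤ.*-identityʳ a) (ℤ.*-identityʳ b))))

fromℤ-* : ∀ a b → fromℤ (a ℤ.* b) ≡ fromℤ a * fromℤ b
fromℤ-* a b = sym (/1≡fromℤ (a ℤ.* b))

fromℤ-neg : ∀ a → fromℤ (ℤ.- a) ≡ - fromℤ a
fromℤ-neg (ℤ.+ zero)  = refl
fromℤ-neg (ℤ.+ suc n) = refl
fromℤ-neg -[1+ n ]    = refl

fromℤ-mono-< : ∀ {a b} → a ℤ.< b → fromℤ a < fromℤ b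
fromℤ-mono-< {a} {b} a<b = *<* (subst₂ ℤ._<_ (sym (ℤ.*-identityʳ a)) (sym (ℤ.*-identityʳ b)) a<b)

IsInt⇒fromℤ : ∀ q → IsInt q → Σ ℤ λ k → q ≡ fromℤ k
IsInt⇒fromℤ (mkℚ k zero _) refl = k , refl

IsInt-fromℤ : ∀ k → IsInt (fromℤ k)
IsInt-fromℤ k = refl

IsInt-+ : ∀ p q → IsInt p → IsInt q → IsInt (p + q)
IsInt-+ p q ip iq with IsInt⇒fromℤ p ip | IsInt⇒fromℤ q iq
... | a , refl | b , refl = subst IsInt (fromℤ-+ a b) (IsInt-fromℤ (a ℤ.+ b))

IsInt-neg : ∀ p → IsInt p → IsInt (- p)
IsInt-neg p ip with IsInt⇒fromℤ p ip
... | a , refl = subst IsInt (fromℤ-neg a) (IsInt-fromℤ (ℤ.- a))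

IsInt-- : ∀ p q → IsInt p → IsInt q → IsInt (p - q)
IsInt-- p q ip iq = IsInt-+ p (- q) ip (IsInt-neg q iq)

IsInt-* : ∀ p q → IsInt p → IsInt q → IsInt (p * q)
IsInt-* p q ip iq with IsInt⇒fromℤ p ip | IsInt⇒fromℤ q iq
... | a , refl | b , refl = subst IsInt (fromℤ-* a b) (IsInt-fromℤ (a ℤ.* b))

ℕ→ℚ≡fromℤ : ∀ m → ℕ→ℚ m ≡ fromℤ (ℤ.+ m)
ℕ→ℚ≡fromℤ m = /1≡fromℤ (ℤ.+ m)

ℕ→ℚ-+ : ∀ m n → ℕ→ℚ (m ℕ.+ n) ≡ ℕ→ℚ m + ℕ→ℚ n
ℕ→ℚ-+ m n = begin
  ℕ→ℚ (m ℕ.+ n)                  ≡⟨ ℕ→ℚ≡fromℤ (m ℕ.+ n) ⟩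
  fromℤ ((ℤ.+ m) ℤ.+ (ℤ.+ n))    ≡⟨ fromℤ-+ (ℤ.+ m) (ℤ.+ n) ⟩
  fromℤ (ℤ.+ m) + fromℤ (ℤ.+ n)  ≡⟨ sym (cong₂ _+_ (ℕ→ℚ≡fromℤ m) (ℕ→ℚ≡fromℤ n)) ⟩
  ℕ→ℚ m + ℕ→ℚ n                  ∎
  where open ≡-Reasoning

ℕ→ℚ-* : ∀ m n → ℕ→ℚ (m ℕ.* n) ≡ ℕ→ℚ m * ℕ→ℚ n
ℕ→ℚ-* m n = begin
  ℕ→ℚ (m ℕ.* n)                  ≡⟨ ℕ→ℚ≡fromℤ (m ℕ.* n) ⟩
  fromℤ (ℤ.+ (m ℕ.* n))          ≡⟨ cong fromℤ (ℤ.pos-* m n) ⟩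
  fromℤ ((ℤ.+ m) ℤ.* (ℤ.+ n))    ≡⟨ fromℤ-* (ℤ.+ m) (ℤ.+ n) ⟩
  fromℤ (ℤ.+ m) * fromℤ (ℤ.+ n)  ≡⟨ sym (cong₂ _*_ (ℕ→ℚ≡fromℤ m) (ℕ→ℚ≡fromℤ n)) ⟩
  ℕ→ℚ m * ℕ→ℚ n                  ∎
  where open ≡-Reasoning

ℕ→ℚ-mono-< : ∀ {m n} → m ℕ.< n → ℕ→ℚ m < ℕ→ℚ n
ℕ→ℚ-mono-< {m} {n} m<n =
  subst₂ _<_ (sym (ℕ→ℚ≡fromℤ m)) (sym (ℕ→ℚ≡fromℤ n)) (fromℤ-mono-< (ℤ.+<+ m<n))

IsInt-ℕ→ℚ : ∀ m → IsInt (ℕ→ℚ m)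
IsInt-ℕ→ℚ m = subst IsInt (sym (ℕ→ℚ≡fromℤ m)) (IsInt-fromℤ (ℤ.+ m))

*-nonneg : ∀ {p q} → 0ℚ ≤ p → 0ℚ ≤ q → 0ℚ ≤ p * q
*-nonneg {p} {q} 0≤p 0≤q = ℚ.nonNegative⁻¹ _ {{ℚ.nonNeg*nonNeg⇒nonNeg p {{nonNegative 0≤p}} q {{nonNegative 0≤q}}}}

*-pos : ∀ {p q} → 0ℚ < p → 0ℚ < q → 0ℚ < p * q
*-pos {p} {q} 0<p 0<q = ℚ.positive⁻¹ _ {{ℚ.pos*pos⇒pos p {{positive 0<p}} q {{positive 0<q}}}}

square-nonneg : ∀ y → 0ℚ ≤ y * y
square-nonneg y with ℚ.≤-total 0ℚ y
... | inj₁ 0≤y = *-nonneg 0≤y 0≤y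
... | inj₂ y≤0 = ℚ.nonNegative⁻¹ _ {{ℚ.nonPos*nonPos⇒nonPos y {{nonPositive y≤0}} y {{nonPositive y≤0}}}}

square-pos : ∀ y → ¬ y ≡ 0ℚ → 0ℚ < y * y
square-pos y y≢0 with ℚ.<-cmp 0ℚ y
... | tri< 0<y _ _ = *-pos 0<y 0<y
... | tri≈ _ 0≡y _ = contradiction (sym 0≡y) y≢0
... | tri> _ _ y<0 = ℚ.positive⁻¹ _ {{ℚ.neg*neg⇒pos y {{negative y<0}} y {{negative y<0}}}}

binary⊎pronic-pos : ∀ y → IsInt y → (y ≡ 0ℚ ⊎ y ≡ 1ℚ) ⊎ 0ℚ < y * (y - 1ℚ)
binary⊎pronic-pos y iy with IsInt⇒fromℤ y iy
... | k , refl = cases k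
  where
  fromℤ-pronic : ∀ k → fromℤ (k ℤ.* (k ℤ.- (ℤ.+ 1))) ≡ fromℤ k * (fromℤ k - 1ℚ)
  fromℤ-pronic k = begin
    fromℤ (k ℤ.* (k ℤ.- (ℤ.+ 1)))        ≡⟨ fromℤ-* k (k ℤ.- (ℤ.+ 1)) ⟩
    fromℤ k * fromℤ (k ℤ.+ ℤ.- (ℤ.+ 1))  ≡⟨ cong (fromℤ k *_) (fromℤ-+ k (ℤ.- (ℤ.+ 1))) ⟩
    fromℤ k * (fromℤ k - 1ℚ)             ∎
    where open ≡-Reasoning
  pos : ∀ k → 0ℚ < fromℤ (k ℤ.* (k ℤ.- (ℤ.+ 1))) → 0ℚ < fromℤ k * (fromℤ k - 1ℚ)
  pos k = subst (0ℚ <_) (fromℤ-pronic k)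
  cases : ∀ k → (fromℤ k ≡ 0ℚ ⊎ fromℤ k ≡ 1ℚ) ⊎ 0ℚ < fromℤ k * (fromℤ k - 1ℚ)
  cases (ℤ.+ zero)        = inj₁ (inj₁ refl)
  cases (ℤ.+ suc zero)    = inj₁ (inj₂ refl)
  cases (ℤ.+ suc (suc m)) = inj₂ (pos (ℤ.+ suc (suc m)) (fromℤ-mono-< (ℤ.+<+ (ℕ.s≤s ℕ.z≤n))))
  cases -[1+ m ]          = inj₂ (pos -[1+ m ] (fromℤ-mono-< (ℤ.+<+ (ℕ.s≤s ℕ.z≤n))))

pronic-nonneg : ∀ y → IsInt y → 0ℚ ≤ y * (y - 1ℚ)
pronic-nonneg y iy with binary⊎pronic-pos y iy
... | inj₁ (inj₁ refl) = ℚ.≤-refl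
... | inj₁ (inj₂ refl) = ℚ.≤-refl
... | inj₂ 0<p         = ℚ.<⇒≤ 0<p

-- y² = ¼ + j (j - 1) for j = y + ½
half-integer-square : ∀ y → IsInt (y - ½) → ¼ ≤ y * y
half-integer-square y iy =
  subst₂ _≤_ (ℚ.+-identityʳ ¼) (sym square≡) (ℚ.+-monoʳ-≤ ¼ (pronic-nonneg j (IsInt-+ (y - ½) 1ℚ iy refl)))
  where
  j = (y - ½) + 1ℚ
  square≡ : y * y ≡ ¼ + j * (j - 1ℚ)
  square≡ = solve 1 (λ y → y :* y := con ¼ :+ ((y :- con ½) :+ con 1ℚ) :* (((y :- con ½) :+ con 1ℚ) :- con 1ℚ)) refl y

data Parity : Set where
  integral halfIntegral : Parity

offset squareBound : Parity → ℚ
offset integral     = 0ℚ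
offset halfIntegral = ½
squareBound integral     = 0ℚ
squareBound halfIntegral = ¼

square-bound : ∀ π y → IsInt (y - offset π) → squareBound π ≤ y * y
square-bound integral     y _  = square-nonneg y
square-bound halfIntegral y iy = half-integer-square y iy

weighted-coset-bound : ∀ π {w c β} x → 0ℚ ≤ w → IsInt (β - (c + offset π)) → IsInt (x - β) →
  w * squareBound π ≤ w * ((x - c) * (x - c))
weighted-coset-bound π {w} {c} {β} x 0≤w iβ ix =
  ℚ.*-monoˡ-≤-nonNeg w {{nonNegative 0≤w}}
    (square-bound π (x - c) (subst IsInt residue (IsInt-+ (x - β) (β - (c + offset π)) ix iβ)))
  where
  residue : (x - β) + (β - (c + offset π)) ≡ (x - c) - offset π
  residue = solve 4 (λ x β c o → (x :- β) :+ (β :- (c :+ o)) := (x :- c) :- o) refl x β c (offset π)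

-- Finite sums

sumFin-cong : ∀ m {f g : Fin m → ℚ} → (∀ i → f i ≡ g i) → sumFin m f ≡ sumFin m g
sumFin-cong zero    f≗g = refl
sumFin-cong (suc m) f≗g = cong₂ _+_ (f≗g Fin.zero) (sumFin-cong m (λ i → f≗g (Fin.suc i)))

sumFin-0 : ∀ m → sumFin m (λ _ → 0ℚ) ≡ 0ℚ
sumFin-0 zero    = refl
sumFin-0 (suc m) = cong (0ℚ +_) (sumFin-0 m)

sumFin-+ : ∀ m (f g : Fin m → ℚ) → sumFin m (λ i → f i + g i) ≡ sumFin m f + sumFin m g
sumFin-+ zero    f g = refl
sumFin-+ (suc m) f g = begin
  (f₀ + g₀) + sumFin m (λ i → f (Fin.suc i) + g (Fin.suc i)) ≡⟨ cong ((f₀ + g₀) +_) (sumFin-+ m _ _) ⟩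
  (f₀ + g₀) + (F + G)                                       ≡⟨ solve 4 (λ a b c d → (a :+ b) :+ (c :+ d) := (a :+ c) :+ (b :+ d)) refl f₀ g₀ F G ⟩
  (f₀ + F) + (g₀ + G)                                       ∎
  where
  open ≡-Reasoning
  f₀ = f Fin.zero
  g₀ = g Fin.zero
  F = sumFin m (λ i → f (Fin.suc i))
  G = sumFin m (λ i → g (Fin.suc i))

sumFin-*ˡ : ∀ m a (f : Fin m → ℚ) → sumFin m (λ i → a * f i) ≡ a * sumFin m f
sumFin-*ˡ zero    a f = sym (ℚ.*-zeroʳ a)
sumFin-*ˡ (suc m) a f = trans (cong (a * f Fin.zero +_) (sumFin-*ˡ m a _)) (sym (ℚ.*-distribˡ-+ a _ _))

sumFin-neg : ∀ m (f : Fin m → ℚ) → sumFin m (λ i → - f i) ≡ - sumFin m f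
sumFin-neg zero    f = refl
sumFin-neg (suc m) f = trans (cong (- f Fin.zero +_) (sumFin-neg m _)) (sym (ℚ.neg-distrib-+ (f Fin.zero) _))

sumFin-- : ∀ m (f g : Fin m → ℚ) → sumFin m (λ i → f i - g i) ≡ sumFin m f - sumFin m g
sumFin-- m f g = trans (sumFin-+ m f (λ i → - g i)) (cong (sumFin m f +_) (sumFin-neg m g))

sumFin-mono-≤ : ∀ m {f g : Fin m → ℚ} → (∀ i → f i ≤ g i) → sumFin m f ≤ sumFin m g
sumFin-mono-≤ zero    f≤g = ℚ.≤-refl
sumFin-mono-≤ (suc m) f≤g = ℚ.+-mono-≤ (f≤g Fin.zero) (sumFin-mono-≤ m (λ i → f≤g (Fin.suc i)))

sumFin-mono-< : ∀ m {f g : Fin m → ℚ} → (∀ i → f i ≤ g i) → ∀ j → f j < g j → sumFin m f < sumFin m g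
sumFin-mono-< (suc m) f≤g Fin.zero    f<g = ℚ.+-mono-<-≤ f<g (sumFin-mono-≤ m (λ i → f≤g (Fin.suc i)))
sumFin-mono-< (suc m) f≤g (Fin.suc j) f<g = ℚ.+-mono-≤-< (f≤g Fin.zero) (sumFin-mono-< m (λ i → f≤g (Fin.suc i)) j f<g)

sumFin-pos : ∀ m {f : Fin m → ℚ} → (∀ i → 0ℚ ≤ f i) → ∀ j → 0ℚ < f j → 0ℚ < sumFin m f
sumFin-pos m {f} 0≤f j 0<fj = subst (_< sumFin m f) (sumFin-0 m) (sumFin-mono-< m 0≤f j 0<fj)

sumFin-const : ∀ m a → sumFin m (λ _ → a) ≡ ℕ→ℚ m * a
sumFin-const zero    a = sym (ℚ.*-zeroˡ a)
sumFin-const (suc m) a = begin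
  a + sumFin m (λ _ → a)   ≡⟨ cong (a +_) (sumFin-const m a) ⟩
  a + ℕ→ℚ m * a            ≡⟨ solve 2 (λ a μ → a :+ μ :* a := (con 1ℚ :+ μ) :* a) refl a (ℕ→ℚ m) ⟩
  (1ℚ + ℕ→ℚ m) * a         ≡⟨ cong (_* a) (sym (ℕ→ℚ-+ 1 m)) ⟩
  ℕ→ℚ (suc m) * a          ∎
  where open ≡-Reasoning

sumFin-indicator : ∀ {A m} a → A ℕ.≤ m → sumFin m (λ i → if toℕ i <ᵇ A then a else 0ℚ) ≡ ℕ→ℚ A * a
sumFin-indicator {zero}  {m}     a _ = trans (sumFin-0 m) (sym (ℚ.*-zeroˡ a))
sumFin-indicator {suc A} {suc m} a (ℕ.s≤s A≤m) = begin
  a + sumFin m (λ i → if toℕ i <ᵇ A then a else 0ℚ)  ≡⟨ cong (a +_) (sumFin-indicator a A≤m) ⟩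
  a + ℕ→ℚ A * a                                      ≡⟨ solve 2 (λ a α → a :+ α :* a := (con 1ℚ :+ α) :* a) refl a (ℕ→ℚ A) ⟩
  (1ℚ + ℕ→ℚ A) * a                                   ≡⟨ cong (_* a) (sym (ℕ→ℚ-+ 1 A)) ⟩
  ℕ→ℚ (suc A) * a                                    ∎
  where open ≡-Reasoning

0<p-q⇒q<p : ∀ p q → 0ℚ < p - q → q < p
0<p-q⇒q<p p q 0<p-q =
  subst₂ _<_ (ℚ.+-identityʳ q) (solve 2 (λ p q → q :+ (p :- q) := p) refl p q) (ℚ.+-monoʳ-< q 0<p-q)

p-q≡0⇒p≡q : ∀ p q → p - q ≡ 0ℚ → p ≡ q
p-q≡0⇒p≡q p q p-q≡0 = begin
  p              ≡⟨ solve 2 (λ p q → p := (p :- q) :+ q) refl p q ⟩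
  (p - q) + q    ≡⟨ cong (_+ q) p-q≡0 ⟩
  0ℚ + q         ≡⟨ ℚ.+-identityˡ q ⟩
  q              ∎
  where open ≡-Reasoning

-- Convex combinations and spheres

sumList : ∀ {a} {A : Set a} → (A → ℚ) → List A → ℚ
sumList h []       = 0ℚ
sumList h (a ∷ as) = h a + sumList h as

sumList-unique : ∀ {a} {A : Set a} (G : List A → ℚ) (h : A → ℚ) →
  G [] ≡ 0ℚ → (∀ a as → G (a ∷ as) ≡ h a + G as) → ∀ L → G L ≡ sumList h L
sumList-unique G h G[] G∷ []       = G[]
sumList-unique G h G[] G∷ (a ∷ as) = trans (G∷ a as) (cong (h a +_) (sumList-unique G h G[] G∷ as))

module _ {a} {A : Set a} (g : ℚ × A → ℚ) (M : ℚ) where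

  Bounded : ℚ × A → Set
  Bounded q = 0ℚ ≤ proj₁ q × g q < M

  sumList-weighted-≤ : ∀ L → All Bounded L → sumList (λ q → proj₁ q * g q) L ≤ sumList proj₁ L * M
  sumList-weighted-≤ []      []                = ℚ.≤-reflexive (sym (ℚ.*-zeroˡ M))
  sumList-weighted-≤ (q ∷ L) ((0≤λ , g<M) ∷ bs) =
    subst (_ ≤_) (sym (ℚ.*-distribʳ-+ M (proj₁ q) (sumList proj₁ L)))
      (ℚ.+-mono-≤ (ℚ.*-monoˡ-≤-nonNeg (proj₁ q) {{nonNegative 0≤λ}} (ℚ.<⇒≤ g<M)) (sumList-weighted-≤ L bs))

  sumList-weighted-< : ∀ L → All Bounded L → 0ℚ < sumList proj₁ L →
    sumList (λ q → proj₁ q * g q) L < sumList proj₁ L * M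
  sumList-weighted-< [] [] 0<0 = contradiction 0<0 (ℚ.<-irrefl refl)
  sumList-weighted-< ((λ₀ , p) ∷ L) ((0≤λ , g<M) ∷ bs) 0<Σλ with ℚ.<-cmp 0ℚ λ₀
  ... | tri< 0<λ _ _ =
    subst (_ <_) (sym (ℚ.*-distribʳ-+ M λ₀ (sumList proj₁ L)))
      (ℚ.+-mono-<-≤ (ℚ.*-monoʳ-<-pos λ₀ {{positive 0<λ}} g<M) (sumList-weighted-≤ L bs))
  ... | tri> _ _ λ<0 = contradiction (ℚ.<-≤-trans λ<0 0≤λ) (ℚ.<-irrefl refl)
  ... | tri≈ _ refl _ = begin-strict
    0ℚ * g (0ℚ , p) + sumList (λ q → proj₁ q * g q) L ≡⟨ cong (_+ sumList (λ q → proj₁ q * g q) L) (ℚ.*-zeroˡ (g (0ℚ , p))) ⟩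
    0ℚ + sumList (λ q → proj₁ q * g q) L              ≡⟨ ℚ.+-identityˡ _ ⟩
    sumList (λ q → proj₁ q * g q) L                   <⟨ sumList-weighted-< L bs (subst (0ℚ <_) (ℚ.+-identityˡ (sumList proj₁ L)) 0<Σλ) ⟩
    sumList proj₁ L * M                               ≡⟨ cong (_* M) (sym (ℚ.+-identityˡ (sumList proj₁ L))) ⟩
    (0ℚ + sumList proj₁ L) * M                        ∎
    where open ℚ.≤-Reasoning

diagForm : ∀ {n} → (Fin (suc n) → ℚ) → Pt n → ℚ
diagForm {n} w x = sumPt n (λ i → w i * (x i * x i))

linear : ∀ {n} → (Fin (suc n) → ℚ) → Pt n → ℚ
linear {n} f x = sumPt n (λ i → f i * x i)

linear-sumList : ∀ {n} (f : Fin (suc n) → ℚ) L →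
  sumList (λ q → proj₁ q * linear f (proj₂ q)) L ≡ linear f (λ i → sumList (λ q → proj₁ q * proj₂ q i) L)
linear-sumList {n} f [] = sym (trans (sumFin-cong (suc n) (λ i → ℚ.*-zeroʳ (f i))) (sumFin-0 (suc n)))
linear-sumList {n} f ((λ₀ , p) ∷ L) = begin
  λ₀ * linear f p + sumList (λ q → proj₁ q * linear f (proj₂ q)) L
    ≡⟨ cong₂ _+_ (sym (sumFin-*ˡ (suc n) λ₀ (λ i → f i * p i))) (linear-sumList f L) ⟩
  sumFin (suc n) (λ i → λ₀ * (f i * p i)) + linear f Σp
    ≡⟨ sym (sumFin-+ (suc n) (λ i → λ₀ * (f i * p i)) (λ i → f i * Σp i)) ⟩
  sumFin (suc n) (λ i → λ₀ * (f i * p i) + f i * Σp i)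
    ≡⟨ sumFin-cong (suc n) (λ i → solve 4 (λ l f p σ → l :* (f :* p) :+ f :* σ := f :* (l :* p :+ σ)) refl λ₀ (f i) (p i) (Σp i)) ⟩
  linear f (λ i → λ₀ * p i + Σp i)
    ∎
  where
  open ≡-Reasoning
  Σp : Pt n
  Σp i = sumList (λ q → proj₁ q * proj₂ q i) L

InConv-linear-< : ∀ {n} {S : Pt n → Set} {x} (f : Fin (suc n) → ℚ) M →
  (∀ p → S p → linear f p < M) → InConv S x → linear f x < M
InConv-linear-< {n} {S} {x} f M bound conv = fromSums conv refl (λ _ _ → refl) (λ _ → refl) (λ _ _ _ → refl)
  where
  -- `InConv` sums over its list with a function local to its definition; abstracting
  -- over the two sums and their defining equations identifies them with `sumList`.
  fromSums : ∀ {G₁ : List (ℚ × Pt n) → ℚ} {G₂ : Fin (suc n) → List (ℚ × Pt n) → ℚ} →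
    (Σ (List (ℚ × Pt n)) λ L → All (λ q → (0ℚ ≤ proj₁ q) × S (proj₂ q)) L × G₁ L ≡ 1ℚ × (∀ i → G₂ i L ≡ x i)) →
    G₁ [] ≡ 0ℚ → (∀ q L → G₁ (q ∷ L) ≡ proj₁ q + G₁ L) →
    (∀ i → G₂ i [] ≡ 0ℚ) → (∀ i q L → G₂ i (q ∷ L) ≡ proj₁ q * proj₂ q i + G₂ i L) →
    linear f x < M
  fromSums {G₁} {G₂} (L , weights , Σλ≡1 , Σλp≡x) G₁[] G₁∷ G₂[] G₂∷ = begin-strict
    linear f x                                          ≡⟨ sumFin-cong (suc n) (λ i → cong (f i *_) (sym (Σλp i))) ⟩
    linear f (λ i → sumList (λ q → proj₁ q * proj₂ q i) L) ≡⟨ sym (linear-sumList f L) ⟩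
    sumList (λ q → proj₁ q * linear f (proj₂ q)) L      <⟨ sumList-weighted-< (λ q → linear f (proj₂ q)) M L bounded 0<Σλ ⟩
    sumList proj₁ L * M                                 ≡⟨ cong (_* M) Σλ ⟩
    1ℚ * M                                              ≡⟨ ℚ.*-identityˡ M ⟩
    M                                                   ∎
    where
    open ℚ.≤-Reasoning
    Σλ : sumList proj₁ L ≡ 1ℚ
    Σλ = trans (sym (sumList-unique G₁ proj₁ G₁[] G₁∷ L)) Σλ≡1
    Σλp : ∀ i → sumList (λ q → proj₁ q * proj₂ q i) L ≡ x i
    Σλp i = trans (sym (sumList-unique (G₂ i) _ (G₂[] i) (G₂∷ i) L)) (Σλp≡x i)
    0<Σλ : 0ℚ < sumList proj₁ L
    0<Σλ = subst (0ℚ <_) (sym Σλ) (ℚ.positive⁻¹ 1ℚ)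
    bounded : All (Bounded (λ q → linear f (proj₂ q)) M) L
    bounded = All.map (λ { (0≤λ , Sp) → 0≤λ , bound _ Sp }) weights

module _ {n} (w : Fin (suc n) → ℚ) (w-pos : ∀ i → 0ℚ < w i) where

  diagForm-pos : ∀ x j → ¬ x j ≡ 0ℚ → 0ℚ < diagForm w x
  diagForm-pos x j xj≢0 = sumFin-pos (suc n)
    (λ i → *-nonneg (ℚ.<⇒≤ (w-pos i)) (square-nonneg (x i))) j (*-pos (w-pos j) (square-pos (x j) xj≢0))

  diagForm-polarisation : ∀ c g p →
    diagForm w (p ⊖ g) ≡ ((diagForm w (p ⊖ c) + diagForm w (g ⊖ c)) - linear (λ i → ℕ→ℚ 2 * w i * (g i - c i)) p)
                           + linear (λ i → ℕ→ℚ 2 * w i * (g i - c i)) c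
  diagForm-polarisation c g p = begin
    diagForm w (p ⊖ g)
      ≡⟨ sumFin-cong (suc n) (λ i → solve 4 (λ w p g c →
           w :* ((p :- g) :* (p :- g))
             := ((w :* ((p :- c) :* (p :- c)) :+ w :* ((g :- c) :* (g :- c))) :- con (ℕ→ℚ 2) :* w :* (g :- c) :* p)
                :+ con (ℕ→ℚ 2) :* w :* (g :- c) :* c) refl (w i) (p i) (g i) (c i)) ⟩
    sumPt n (λ i → ((P i + G i) - f i * p i) + f i * c i)
      ≡⟨ sumFin-+ (suc n) (λ i → (P i + G i) - f i * p i) (λ i → f i * c i) ⟩
    sumPt n (λ i → (P i + G i) - f i * p i) + linear f c
      ≡⟨ cong (_+ linear f c) (sumFin-- (suc n) (λ i → P i + G i) (λ i → f i * p i)) ⟩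
    (sumPt n (λ i → P i + G i) - linear f p) + linear f c
      ≡⟨ cong (λ u → (u - linear f p) + linear f c) (sumFin-+ (suc n) P G) ⟩
    ((diagForm w (p ⊖ c) + diagForm w (g ⊖ c)) - linear f p) + linear f c
      ∎
    where
    open ≡-Reasoning
    f P G : Fin (suc n) → ℚ
    f i = ℕ→ℚ 2 * w i * (g i - c i)
    P i = w i * ((p i - c i) * (p i - c i))
    G i = w i * ((g i - c i) * (g i - c i))

  -- Polarising the form at g gives a linear form f with f < M at every other point of the
  -- sphere and f g = M, so g is no convex combination of those points.
  sphere-point-extreme : ∀ {S : Pt n → Set} c g R →
    (∀ p → S p → diagForm w (p ⊖ c) ≡ R) → diagForm w (g ⊖ c) ≡ R →
    ¬ InConv (λ p → S p × ¬ (∀ i → p i ≡ g i)) g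
  sphere-point-extreme {S} c g R on-sphere g-on-sphere conv =
    ℚ.<-irrefl g-attains (InConv-linear-< f M below conv)
    where
    f : Fin (suc n) → ℚ
    f i = ℕ→ℚ 2 * w i * (g i - c i)
    M = (R + R) + linear f c
    polar : ∀ p → diagForm w (p ⊖ c) ≡ R → diagForm w (p ⊖ g) ≡ M - linear f p
    polar p p-on-sphere = begin
      diagForm w (p ⊖ g)                                                   ≡⟨ diagForm-polarisation c g p ⟩
      ((diagForm w (p ⊖ c) + diagForm w (g ⊖ c)) - linear f p) + linear f c ≡⟨ cong₂ (λ u v → ((u + v) - linear f p) + linear f c) p-on-sphere g-on-sphere ⟩
      ((R + R) - linear f p) + linear f c                                  ≡⟨ solve 3 (λ r l c → ((r :+ r) :- l) :+ c := ((r :+ r) :+ c) :- l) refl R (linear f p) (linear f c) ⟩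
      M - linear f p                                                       ∎
      where open ≡-Reasoning
    below : ∀ p → S p × ¬ (∀ i → p i ≡ g i) → linear f p < M
    below p (Sp , p≢g) with Fin.¬∀⟶∃¬ (suc n) (λ i → p i ≡ g i) (λ i → p i ℚ.≟ g i) p≢g
    ... | j , pj≢gj = 0<p-q⇒q<p M (linear f p)
      (subst (0ℚ <_) (polar p (on-sphere p Sp)) (diagForm-pos (p ⊖ g) j (λ eq → pj≢gj (p-q≡0⇒p≡q (p j) (g j) eq))))
    g-attains : linear f g ≡ M
    g-attains = p-q≡0⇒p≡q (linear f g) M (begin
      linear f g - M        ≡⟨ solve 2 (λ l m → l :- m := :- (m :- l)) refl (linear f g) M ⟩
      - (M - linear f g)    ≡⟨ cong -_ (sym (polar g g-on-sphere)) ⟩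
      - diagForm w (g ⊖ g)  ≡⟨ cong -_ (trans (sumFin-cong (suc n) (λ i → zero-square i)) (sumFin-0 (suc n))) ⟩
      - 0ℚ                  ≡⟨⟩
      0ℚ                    ∎)
      where
      open ≡-Reasoning
      zero-square : ∀ i → w i * ((g i - g i) * (g i - g i)) ≡ 0ℚ
      zero-square i = solve 2 (λ w g → w :* ((g :- g) :* (g :- g)) := con 0ℚ) refl (w i) (g i)

reflectThrough : ∀ {n} → Pt n → Pt n → Pt n
reflectThrough c x i = ℕ→ℚ 2 * c i - x i

reflectThrough-involutive : ∀ {n} (c x : Pt n) i → reflectThrough c (reflectThrough c x) i ≡ x i
reflectThrough-involutive c x i = solve 2 (λ c x → con (ℕ→ℚ 2) :* c :- (con (ℕ→ℚ 2) :* c :- x) := x) refl (c i) (x i)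

diagForm-reflectThrough : ∀ {n} (w : Fin (suc n) → ℚ) (c x : Pt n) →
  diagForm w (reflectThrough c x ⊖ c) ≡ diagForm w (x ⊖ c)
diagForm-reflectThrough {n} w c x = sumFin-cong (suc n) (λ i → solve 3 (λ w c x →
  w :* ((con (ℕ→ℚ 2) :* c :- x :- c) :* (con (ℕ→ℚ 2) :* c :- x :- c)) := w :* ((x :- c) :* (x :- c))) refl (w i) (c i) (x i))

sum-reflectThrough : ∀ {n} (c x : Pt n) → sumPt n (reflectThrough c x) ≡ ℕ→ℚ 2 * sumPt n c - sumPt n x
sum-reflectThrough {n} c x =
  trans (sumFin-- (suc n) (λ i → ℕ→ℚ 2 * c i) x) (cong (_- sumPt n x) (sumFin-*ˡ (suc n) (ℕ→ℚ 2) c))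

-- Coordinate blocks

data Block : Set where
  first second pivot tail : Block

byBlock : ∀ {a} {A : Set a} → A → A → A → A → Block → A
byBlock x y z u first  = x
byBlock x y z u second = y
byBlock x y z u pivot  = z
byBlock x y z u tail   = u

byBlock-η : (f : Block → ℚ) → ∀ β → f β ≡ byBlock (f first) (f second) (f pivot) (f tail) β
byBlock-η f first  = refl
byBlock-η f second = refl
byBlock-η f pivot  = refl
byBlock-η f tail   = refl

blockOf : Bool → Bool → Bool → Block
blockOf b₁ b₂ b₃ = if b₁ then first else if b₂ then second else if b₃ then pivot else tail

block : ℕ → ℕ → Block
block s k = blockOf (k <ᵇ 2 ℕ.* s) (k <ᵇ 4 ℕ.* s) (k ≡ᵇ 4 ℕ.* s)

-- The possible outcomes of the tests k < 2s, k < 4s, k = 4s and k < 4s + 1.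
data BlockBits : Bool → Bool → Bool → Bool → Set where
  first  : BlockBits true  true  false true
  second : BlockBits false true  false true
  pivot  : BlockBits false false true  true
  tail   : BlockBits false false false false

blockBits : ∀ s k → BlockBits (k <ᵇ 2 ℕ.* s) (k <ᵇ 4 ℕ.* s) (k ≡ᵇ 4 ℕ.* s) (k <ᵇ suc (4 ℕ.* s))
blockBits s k = bits (ℕ.<ᵇ-reflects-< k (2 ℕ.* s)) (ℕ.<ᵇ-reflects-< k (4 ℕ.* s))
                     (fromEquivalence (ℕ.≡ᵇ⇒≡ k (4 ℕ.* s)) (ℕ.≡⇒≡ᵇ k (4 ℕ.* s))) (ℕ.<ᵇ-reflects-< k (suc (4 ℕ.* s)))
  where
  2s≤4s : 2 ℕ.* s ℕ.≤ 4 ℕ.* s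
  2s≤4s = ℕ.*-monoˡ-≤ s {2} {4} (ℕ.s≤s (ℕ.s≤s ℕ.z≤n))
  bits : ∀ {b₁ b₂ b₃ b₄} → Reflects (k ℕ.< 2 ℕ.* s) b₁ → Reflects (k ℕ.< 4 ℕ.* s) b₂ →
         Reflects (k ≡ 4 ℕ.* s) b₃ → Reflects (k ℕ.< suc (4 ℕ.* s)) b₄ → BlockBits b₁ b₂ b₃ b₄
  bits (ofʸ _)    (ofʸ _)    (ofⁿ _)    (ofʸ _)      = first
  bits (ofⁿ _)    (ofʸ _)    (ofⁿ _)    (ofʸ _)      = second
  bits (ofⁿ _)    (ofⁿ _)    (ofʸ _)    (ofʸ _)      = pivot
  bits (ofⁿ _)    (ofⁿ _)    (ofⁿ _)    (ofⁿ _)      = tail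
  bits (ofʸ k<2s) (ofⁿ k≮4s) _          _            = contradiction (ℕ.<-≤-trans k<2s 2s≤4s) k≮4s
  bits _          (ofʸ k<4s) (ofʸ k≡4s) _            = contradiction k<4s (ℕ.<-irrefl k≡4s)
  bits _          (ofʸ k<4s) _          (ofⁿ k≮4s+1) = contradiction (ℕ.m<n⇒m<1+n k<4s) k≮4s+1
  bits _          _          (ofʸ k≡4s) (ofⁿ k≮4s+1) = contradiction (ℕ.s≤s (ℕ.≤-reflexive k≡4s)) k≮4s+1
  bits _          (ofⁿ k≮4s) (ofⁿ k≢4s) (ofʸ k<4s+1) = contradiction (ℕ.≤∧≢⇒< (ℕ.≤-pred k<4s+1) k≢4s) k≮4s

if-<4s⇒byBlock : ∀ {b₁ b₂ b₃ b₄} (x y : ℚ) → BlockBits b₁ b₂ b₃ b₄ →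
  (if b₂ then x else y) ≡ byBlock x x y y (blockOf b₁ b₂ b₃)
if-<4s⇒byBlock x y first  = refl
if-<4s⇒byBlock x y second = refl
if-<4s⇒byBlock x y pivot  = refl
if-<4s⇒byBlock x y tail   = refl

if-<2s-<4s⇒byBlock : ∀ {b₁ b₂ b₃ b₄} (x y z : ℚ) → BlockBits b₁ b₂ b₃ b₄ →
  (if b₁ then x else if b₂ then y else z) ≡ byBlock x y z z (blockOf b₁ b₂ b₃)
if-<2s-<4s⇒byBlock x y z first  = refl
if-<2s-<4s⇒byBlock x y z second = refl
if-<2s-<4s⇒byBlock x y z pivot  = refl
if-<2s-<4s⇒byBlock x y z tail   = refl

if-<2s-<4s-≡4s⇒byBlock : ∀ {b₁ b₂ b₃ b₄} (x y z u : ℚ) → BlockBits b₁ b₂ b₃ b₄ →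
  (if b₁ then x else if b₂ then y else if b₃ then z else u) ≡ byBlock x y z u (blockOf b₁ b₂ b₃)
if-<2s-<4s-≡4s⇒byBlock x y z u first  = refl
if-<2s-<4s-≡4s⇒byBlock x y z u second = refl
if-<2s-<4s-≡4s⇒byBlock x y z u pivot  = refl
if-<2s-<4s-≡4s⇒byBlock x y z u tail   = refl

byBlock-indicators : ∀ {b₁ b₂ b₃ b₄} x y z u → BlockBits b₁ b₂ b₃ b₄ →
  byBlock x y z u (blockOf b₁ b₂ b₃)
    ≡ ((u + (if b₄ then z - u else 0ℚ)) + (if b₂ then y - z else 0ℚ)) + (if b₁ then x - y else 0ℚ)
byBlock-indicators x y z u first  = solve 4 (λ x y z u → x := ((u :+ (z :- u)) :+ (y :- z)) :+ (x :- y)) refl x y z u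
byBlock-indicators x y z u second = solve 3 (λ y z u → y := ((u :+ (z :- u)) :+ (y :- z)) :+ con 0ℚ) refl y z u
byBlock-indicators x y z u pivot  = solve 2 (λ z u → z := ((u :+ (z :- u)) :+ con 0ℚ) :+ con 0ℚ) refl z u
byBlock-indicators x y z u tail   = solve 1 (λ u → u := ((u :+ con 0ℚ) :+ con 0ℚ) :+ con 0ℚ) refl u

ℕ→ℚ-4* : ∀ s → ℕ→ℚ (4 ℕ.* s) ≡ ℕ→ℚ (2 ℕ.* s) + ℕ→ℚ (2 ℕ.* s)
ℕ→ℚ-4* s = trans (cong ℕ→ℚ (ℕ.*-distribʳ-+ s 2 2)) (ℕ→ℚ-+ (2 ℕ.* s) (2 ℕ.* s))

ℕ→ℚ-split : ∀ n s → 4 ℕ.* s ℕ.≤ n → ℕ→ℚ n ≡ (ℕ→ℚ (2 ℕ.* s) + ℕ→ℚ (2 ℕ.* s)) + ℕ→ℚ (n ℕ.∸ 4 ℕ.* s)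
ℕ→ℚ-split n s 4s≤n = begin
  ℕ→ℚ n                                     ≡⟨ cong ℕ→ℚ (sym (ℕ.m+[n∸m]≡n 4s≤n)) ⟩
  ℕ→ℚ (4 ℕ.* s ℕ.+ (n ℕ.∸ 4 ℕ.* s))         ≡⟨ ℕ→ℚ-+ (4 ℕ.* s) (n ℕ.∸ 4 ℕ.* s) ⟩
  ℕ→ℚ (4 ℕ.* s) + ℕ→ℚ (n ℕ.∸ 4 ℕ.* s)       ≡⟨ cong (_+ ℕ→ℚ (n ℕ.∸ 4 ℕ.* s)) (ℕ→ℚ-4* s) ⟩
  (ℕ→ℚ (2 ℕ.* s) + ℕ→ℚ (2 ℕ.* s)) + ℕ→ℚ (n ℕ.∸ 4 ℕ.* s) ∎
  where open ≡-Reasoning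

sumPt-block : ∀ n s → 4 ℕ.* s ℕ.≤ n → (f : Block → ℚ) →
  sumPt n (λ i → f (block s (toℕ i)))
    ≡ (ℕ→ℚ (2 ℕ.* s) * (f first + f second) + f pivot) + ℕ→ℚ (n ℕ.∸ 4 ℕ.* s) * f tail
sumPt-block n s 4s≤n f = begin
  sumPt n (λ i → f (block s (toℕ i)))
    ≡⟨ sumFin-cong (suc n) (λ i → trans (byBlock-η f (block s (toℕ i)))
                                        (byBlock-indicators x y z u (blockBits s (toℕ i)))) ⟩
  sumPt n (λ i → ((u + I₄ (toℕ i)) + I₂ (toℕ i)) + I₁ (toℕ i))
    ≡⟨ sumFin-+ (suc n) (λ i → (u + I₄ (toℕ i)) + I₂ (toℕ i)) (I₁ ∘ toℕ) ⟩
  sumPt n (λ i → (u + I₄ (toℕ i)) + I₂ (toℕ i)) + sumPt n (I₁ ∘ toℕ)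
    ≡⟨ cong (_+ sumPt n (I₁ ∘ toℕ)) (sumFin-+ (suc n) (λ i → u + I₄ (toℕ i)) (I₂ ∘ toℕ)) ⟩
  (sumPt n (λ i → u + I₄ (toℕ i)) + sumPt n (I₂ ∘ toℕ)) + sumPt n (I₁ ∘ toℕ)
    ≡⟨ cong (λ v → (v + sumPt n (I₂ ∘ toℕ)) + sumPt n (I₁ ∘ toℕ)) (sumFin-+ (suc n) (λ _ → u) (I₄ ∘ toℕ)) ⟩
  ((sumPt n (λ _ → u) + sumPt n (I₄ ∘ toℕ)) + sumPt n (I₂ ∘ toℕ)) + sumPt n (I₁ ∘ toℕ)
    ≡⟨ cong₂ _+_ (cong₂ _+_ (cong₂ _+_ (sumFin-const (suc n) u) (sumFin-indicator (z - u) (ℕ.s≤s 4s≤n)))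
                            (sumFin-indicator (y - z) 4s≤n+1))
                 (sumFin-indicator (x - y) (ℕ.≤-trans 2s≤4s 4s≤n+1)) ⟩
  ((ℕ→ℚ (suc n) * u + ℕ→ℚ (suc (4 ℕ.* s)) * (z - u)) + ℕ→ℚ (4 ℕ.* s) * (y - z)) + σ₂ * (x - y)
    ≡⟨ cong₂ (λ N F → ((N * u + F * (z - u)) + ℕ→ℚ (4 ℕ.* s) * (y - z)) + σ₂ * (x - y)) suc-n≡ suc-4s≡ ⟩
  (((1ℚ + ((σ₂ + σ₂) + μ)) * u + (1ℚ + (σ₂ + σ₂)) * (z - u)) + ℕ→ℚ (4 ℕ.* s) * (y - z)) + σ₂ * (x - y)
    ≡⟨ cong (λ F → (((1ℚ + ((σ₂ + σ₂) + μ)) * u + (1ℚ + (σ₂ + σ₂)) * (z - u)) + F * (y - z)) + σ₂ * (x - y)) (ℕ→ℚ-4* s) ⟩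
  (((1ℚ + ((σ₂ + σ₂) + μ)) * u + (1ℚ + (σ₂ + σ₂)) * (z - u)) + (σ₂ + σ₂) * (y - z)) + σ₂ * (x - y)
    ≡⟨ solve 6 (λ σ₂ μ x y z u →
         (((con 1ℚ :+ ((σ₂ :+ σ₂) :+ μ)) :* u :+ (con 1ℚ :+ (σ₂ :+ σ₂)) :* (z :- u)) :+ (σ₂ :+ σ₂) :* (y :- z)) :+ σ₂ :* (x :- y)
           := (σ₂ :* (x :+ y) :+ z) :+ μ :* u) refl σ₂ μ x y z u ⟩
  (σ₂ * (x + y) + z) + μ * u
    ∎
  where
  open ≡-Reasoning
  x = f first
  y = f second
  z = f pivot
  u = f tail
  σ₂ = ℕ→ℚ (2 ℕ.* s)
  μ = ℕ→ℚ (n ℕ.∸ 4 ℕ.* s)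
  I₁ I₂ I₄ : ℕ → ℚ
  I₁ k = if k <ᵇ 2 ℕ.* s then x - y else 0ℚ
  I₂ k = if k <ᵇ 4 ℕ.* s then y - z else 0ℚ
  I₄ k = if k <ᵇ suc (4 ℕ.* s) then z - u else 0ℚ
  4s≤n+1 : 4 ℕ.* s ℕ.≤ suc n
  4s≤n+1 = ℕ.m≤n⇒m≤1+n 4s≤n
  2s≤4s : 2 ℕ.* s ℕ.≤ 4 ℕ.* s
  2s≤4s = ℕ.*-monoˡ-≤ s {2} {4} (ℕ.s≤s (ℕ.s≤s ℕ.z≤n))
  suc-4s≡ : ℕ→ℚ (suc (4 ℕ.* s)) ≡ 1ℚ + (σ₂ + σ₂)
  suc-4s≡ = trans (ℕ→ℚ-+ 1 (4 ℕ.* s)) (cong (1ℚ +_) (ℕ→ℚ-4* s))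
  suc-n≡ : ℕ→ℚ (suc n) ≡ 1ℚ + ((σ₂ + σ₂) + μ)
  suc-n≡ = trans (ℕ→ℚ-+ 1 n) (cong (1ℚ +_) (ℕ→ℚ-split n s 4s≤n))

-- The polytope P(n,s)

radius : ℕ → ℚ
radius s = ℕ→ℚ (6 ℕ.* s) * ¼

radius-pos : ∀ {s} → 1 ℕ.≤ s → 0ℚ < radius s
radius-pos {s} 1≤s = *-pos (ℕ→ℚ-mono-< (ℕ.*-mono-≤ {1} {6} (ℕ.s≤s ℕ.z≤n) 1≤s)) (ℚ.positive⁻¹ ¼)

weightAt : ℕ → ℕ → ℚ
weightAt s k = if k <ᵇ 4 ℕ.* s then ℕ→ℚ 2 else 1ℚ

weightAt-pos : ∀ s k → 0ℚ < weightAt s k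
weightAt-pos s k with k <ᵇ 4 ℕ.* s
... | true  = ℚ.positive⁻¹ (ℕ→ℚ 2)
... | false = ℚ.positive⁻¹ 1ℚ

binary? : ∀ q → Dec (q ≡ 0ℚ ⊎ q ≡ 1ℚ)
binary? q = (q ℚ.≟ 0ℚ) ⊎-dec (q ℚ.≟ 1ℚ)

vBlock tBlock : Block → ℚ
vBlock = byBlock ¼ ¼ 0ℚ 0ℚ
tBlock = byBlock ½ (- ½) 0ℚ 0ℚ

JVertex⇒InV : ∀ n s x → IsJVertex n s x → InV n s x
JVertex⇒InV n s x (binary , Σx≡s) = (λ i → binary⇒IsInt (binary i)) , Σx≡s
  where
  binary⇒IsInt : ∀ {q} → q ≡ 0ℚ ⊎ q ≡ 1ℚ → IsInt q
  binary⇒IsInt (inj₁ refl) = refl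
  binary⇒IsInt (inj₂ refl) = refl

weightBlock : Block → ℚ
weightBlock = byBlock (ℕ→ℚ 2) (ℕ→ℚ 2) 1ℚ 1ℚ

weightBlock-nonneg : ∀ β → 0ℚ ≤ weightBlock β
weightBlock-nonneg first  = ℚ.nonNegative⁻¹ (ℕ→ℚ 2)
weightBlock-nonneg second = ℚ.nonNegative⁻¹ (ℕ→ℚ 2)
weightBlock-nonneg pivot  = ℚ.nonNegative⁻¹ 1ℚ
weightBlock-nonneg tail   = ℚ.nonNegative⁻¹ 1ℚ

-- w_{n,s} up to its multiple of e₁; `odd` is the parity of n
wBlock : Bool → Block → ℚ
wBlock odd = byBlock ¼ (- ¼) (if odd then ½ else 0ℚ) ½

-- coset representative of w_{n,s} + V_{n,s} (unshifted) or w_{n,s} + t_{n,s} + V_{n,s} (shifted), modulo ℤ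
cosetRep : Bool → Bool → Block → ℚ
cosetRep odd shifted β = wBlock odd β + (if shifted then tBlock β else 0ℚ)

-- whether the coordinates of x - v_{n,s} are integers or half-integers on that coset
cosetParity : Bool → Bool → Block → Parity
cosetParity odd shifted = byBlock (if shifted then halfIntegral else integral) (if shifted then integral else halfIntegral)
                                  (if odd then halfIntegral else integral) halfIntegral

coset-residue : ∀ odd shifted β → IsInt (cosetRep odd shifted β - (vBlock β + offset (cosetParity odd shifted β)))
coset-residue _     false first  = refl
coset-residue _     true  first  = refl
coset-residue _     false second = refl
coset-residue _     true  second = refl
coset-residue false false pivot  = refl
coset-residue false true  pivot  = refl
coset-residue true  false pivot  = refl
coset-residue true  true  pivot  = refl
coset-residue _     false tail   = refl
coset-residue _     true  tail   = refl

cosetBound : Bool → Bool → Block → ℚ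
cosetBound odd shifted β = weightBlock β * squareBound (cosetParity odd shifted β)

cosetBound-first+second : ∀ odd shifted → cosetBound odd shifted first + cosetBound odd shifted second ≡ ½
cosetBound-first+second _ false = refl
cosetBound-first+second _ true  = refl

cosetBound-sum : ∀ n s odd shifted → 4 ℕ.* s ℕ.≤ n →
  sumPt n (λ i → cosetBound odd shifted (block s (toℕ i))) ≡ ℕ→ℚ (if odd then suc n else n) * ¼
cosetBound-sum n s odd shifted 4s≤n = begin
  sumPt n (λ i → cosetBound odd shifted (block s (toℕ i)))
    ≡⟨ sumPt-block n s 4s≤n (cosetBound odd shifted) ⟩
  (σ₂ * (cosetBound odd shifted first + cosetBound odd shifted second) + cosetBound odd shifted pivot) + μ * cosetBound odd shifted tail
    ≡⟨ cong (λ a → (σ₂ * a + cosetBound odd shifted pivot) + μ * ¼) (cosetBound-first+second odd shifted) ⟩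
  (σ₂ * ½ + cosetBound odd shifted pivot) + μ * ¼
    ≡⟨ total odd ⟩
  ℕ→ℚ (if odd then suc n else n) * ¼
    ∎
  where
  open ≡-Reasoning
  σ₂ = ℕ→ℚ (2 ℕ.* s)
  μ = ℕ→ℚ (n ℕ.∸ 4 ℕ.* s)
  total : ∀ odd → (σ₂ * ½ + cosetBound odd shifted pivot) + μ * ¼ ≡ ℕ→ℚ (if odd then suc n else n) * ¼
  total true  = begin
    (σ₂ * ½ + ¼) + μ * ¼                 ≡⟨ solve 2 (λ σ μ → (σ :* con ½ :+ con ¼) :+ μ :* con ¼ := (con 1ℚ :+ ((σ :+ σ) :+ μ)) :* con ¼) refl σ₂ μ ⟩
    (1ℚ + ((σ₂ + σ₂) + μ)) * ¼           ≡⟨ cong (λ m → (1ℚ + m) * ¼) (sym (ℕ→ℚ-split n s 4s≤n)) ⟩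
    (1ℚ + ℕ→ℚ n) * ¼                     ≡⟨ cong (_* ¼) (sym (ℕ→ℚ-+ 1 n)) ⟩
    ℕ→ℚ (suc n) * ¼                      ∎
  total false = begin
    (σ₂ * ½ + 0ℚ) + μ * ¼                ≡⟨ solve 2 (λ σ μ → (σ :* con ½ :+ con 0ℚ) :+ μ :* con ¼ := ((σ :+ σ) :+ μ) :* con ¼) refl σ₂ μ ⟩
    ((σ₂ + σ₂) + μ) * ¼                  ≡⟨ cong (_* ¼) (sym (ℕ→ℚ-split n s 4s≤n)) ⟩
    ℕ→ℚ n * ¼                            ∎

evenOf : ℕ → ℕ
evenOf n = if isOdd n then suc n else n

evenOf-even : ∀ n → Σ ℕ λ k → evenOf n ≡ 2 ℕ.* k
evenOf-even zero = 0 , refl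
evenOf-even (suc n) with isOdd n | evenOf-even n
... | true  | k , n+1≡2k = k , n+1≡2k
... | false | k , n≡2k   = suc k , trans (cong (suc ∘ suc) n≡2k) (sym (ℕ.*-suc 2 k))

evenOf≤1+n : ∀ n → evenOf n ℕ.≤ suc n
evenOf≤1+n n with isOdd n
... | true  = ℕ.≤-refl
... | false = ℕ.n≤1+n n

-- the multiple of e₁ subtracted in w_{n,s}
wShift : ℕ → ℕ → ℚ
wShift n s = ℕ→ℚ (evenOf n ℕ.∸ 4 ℕ.* s) * ½

IsInt-wShift : ∀ n s → IsInt (wShift n s)
IsInt-wShift n s with evenOf-even n
... | k , N≡2k = subst IsInt (sym shift≡) (IsInt-ℕ→ℚ (k ℕ.∸ 2 ℕ.* s))
  where
  shift≡ : wShift n s ≡ ℕ→ℚ (k ℕ.∸ 2 ℕ.* s)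
  shift≡ = begin
    ℕ→ℚ (evenOf n ℕ.∸ 4 ℕ.* s) * ½                  ≡⟨ cong (λ m → ℕ→ℚ m * ½) (cong₂ ℕ._∸_ N≡2k (ℕ.*-assoc 2 2 s)) ⟩
    ℕ→ℚ (2 ℕ.* k ℕ.∸ 2 ℕ.* (2 ℕ.* s)) * ½            ≡⟨ cong (λ m → ℕ→ℚ m * ½) (sym (ℕ.*-distribˡ-∸ 2 k (2 ℕ.* s))) ⟩
    ℕ→ℚ (2 ℕ.* (k ℕ.∸ 2 ℕ.* s)) * ½                  ≡⟨ cong (_* ½) (ℕ→ℚ-* 2 (k ℕ.∸ 2 ℕ.* s)) ⟩
    ℕ→ℚ 2 * ℕ→ℚ (k ℕ.∸ 2 ℕ.* s) * ½                  ≡⟨ solve 1 (λ j → con (ℕ→ℚ 2) :* j :* con ½ := j) refl _ ⟩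
    ℕ→ℚ (k ℕ.∸ 2 ℕ.* s)                              ∎
    where open ≡-Reasoning

IsInt-wShift*e1 : ∀ n s i → IsInt (wShift n s * e1 n i)
IsInt-wShift*e1 n s i = IsInt-* (wShift n s) (e1 n i) (IsInt-wShift n s) IsInt-e1
  where
  IsInt-e1 : IsInt (e1 n i)
  IsInt-e1 with toℕ i ≡ᵇ 1
  ... | true  = refl
  ... | false = refl

wns-block : ∀ n s i → wns n s i ≡ wBlock (isOdd n) (block s (toℕ i)) - wShift n s * e1 n i
wns-block n s i with isOdd n
... | true  = cong (_- ℕ→ℚ (suc n ℕ.∸ 4 ℕ.* s) * ½ * e1 n i) (if-<2s-<4s⇒byBlock ¼ (- ¼) ½ (blockBits s (toℕ i)))
... | false = cong (_- ℕ→ℚ (n ℕ.∸ 4 ℕ.* s) * ½ * e1 n i) (if-<2s-<4s-≡4s⇒byBlock ¼ (- ¼) 0ℚ ½ (blockBits s (toℕ i)))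

module _ (n s : ℕ) where

  private
    weights : Fin (suc n) → ℚ
    weights i = weightAt s (toℕ i)

  vns-sum : 4 ℕ.* s ℕ.≤ suc n → sumPt n (vns n s) ≡ ℕ→ℚ s
  vns-sum 4s≤n+1 = begin
    sumPt n (vns n s)          ≡⟨ sumFin-indicator ¼ 4s≤n+1 ⟩
    ℕ→ℚ (4 ℕ.* s) * ¼          ≡⟨ cong (_* ¼) (ℕ→ℚ-* 4 s) ⟩
    ℕ→ℚ 4 * ℕ→ℚ s * ¼          ≡⟨ solve 1 (λ σ → con (ℕ→ℚ 4) :* σ :* con ¼ := σ) refl (ℕ→ℚ s) ⟩
    ℕ→ℚ s                      ∎
    where open ≡-Reasoning

  latticeExcess : Pt n → ℚ
  latticeExcess y = sumPt n (λ i → weights i * (y i * (y i - 1ℚ)))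

  qns-around-vns : ∀ y → 4 ℕ.* s ℕ.≤ suc n → sumPt n y ≡ ℕ→ℚ s →
    qns n s (y ⊖ vns n s) ≡ radius s + latticeExcess y
  qns-around-vns y 4s≤n+1 Σy≡s = begin
    qns n s (y ⊖ vns n s)
      ≡⟨ sumFin-cong (suc n) (λ i → term (toℕ i <ᵇ 4 ℕ.* s) (y i)) ⟩
    sumPt n (λ i → (I (toℕ i) + y i) + E i)
      ≡⟨ sumFin-+ (suc n) (λ i → I (toℕ i) + y i) E ⟩
    sumPt n (λ i → I (toℕ i) + y i) + latticeExcess y
      ≡⟨ cong (_+ latticeExcess y) (sumFin-+ (suc n) (I ∘ toℕ) y) ⟩
    (sumPt n (I ∘ toℕ) + sumPt n y) + latticeExcess y
      ≡⟨ cong₂ (λ a b → (a + b) + latticeExcess y) (sumFin-indicator (¼ * ½) 4s≤n+1) Σy≡s ⟩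
    (ℕ→ℚ (4 ℕ.* s) * (¼ * ½) + ℕ→ℚ s) + latticeExcess y
      ≡⟨ cong (_+ latticeExcess y) radius≡ ⟩
    radius s + latticeExcess y
      ∎
    where
    open ≡-Reasoning
    I : ℕ → ℚ
    I k = if k <ᵇ 4 ℕ.* s then ¼ * ½ else 0ℚ
    E : Fin (suc n) → ℚ
    E i = weights i * (y i * (y i - 1ℚ))
    term : ∀ b y → (if b then ℕ→ℚ 2 else 1ℚ) * ((y - (if b then ¼ else 0ℚ)) * (y - (if b then ¼ else 0ℚ)))
                   ≡ ((if b then ¼ * ½ else 0ℚ) + y) + (if b then ℕ→ℚ 2 else 1ℚ) * (y * (y - 1ℚ))
    term true  = solve 1 (λ y → con (ℕ→ℚ 2) :* ((y :- con ¼) :* (y :- con ¼))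
                                := (con (¼ * ½) :+ y) :+ con (ℕ→ℚ 2) :* (y :* (y :- con 1ℚ))) refl
    term false = solve 1 (λ y → con 1ℚ :* ((y :- con 0ℚ) :* (y :- con 0ℚ))
                                := (con 0ℚ :+ y) :+ con 1ℚ :* (y :* (y :- con 1ℚ))) refl
    radius≡ : ℕ→ℚ (4 ℕ.* s) * (¼ * ½) + ℕ→ℚ s ≡ radius s
    radius≡ = begin
      ℕ→ℚ (4 ℕ.* s) * (¼ * ½) + ℕ→ℚ s    ≡⟨ cong (λ a → a * (¼ * ½) + ℕ→ℚ s) (ℕ→ℚ-* 4 s) ⟩
      ℕ→ℚ 4 * ℕ→ℚ s * (¼ * ½) + ℕ→ℚ s    ≡⟨ solve 1 (λ σ → con (ℕ→ℚ 4) :* σ :* con (¼ * ½) :+ σ := con (ℕ→ℚ 6) :* σ :* con ¼) refl (ℕ→ℚ s) ⟩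
      ℕ→ℚ 6 * ℕ→ℚ s * ¼                  ≡⟨ cong (_* ¼) (sym (ℕ→ℚ-* 6 s)) ⟩
      radius s                           ∎

  JVertex-on-sphere : ∀ y → 4 ℕ.* s ℕ.≤ suc n → IsJVertex n s y → qns n s (y ⊖ vns n s) ≡ radius s
  JVertex-on-sphere y 4s≤n+1 (binary , Σy≡s) = begin
    qns n s (y ⊖ vns n s)        ≡⟨ qns-around-vns y 4s≤n+1 Σy≡s ⟩
    radius s + latticeExcess y   ≡⟨ cong (radius s +_) (trans (sumFin-cong (suc n) excess-0) (sumFin-0 (suc n))) ⟩
    radius s + 0ℚ                ≡⟨ ℚ.+-identityʳ (radius s) ⟩
    radius s                     ∎
    where
    open ≡-Reasoning
    pronic-0 : ∀ q → q ≡ 0ℚ ⊎ q ≡ 1ℚ → q * (q - 1ℚ) ≡ 0ℚ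
    pronic-0 q (inj₁ refl) = refl
    pronic-0 q (inj₂ refl) = refl
    excess-0 : ∀ i → weights i * (y i * (y i - 1ℚ)) ≡ 0ℚ
    excess-0 i = trans (cong (weights i *_) (pronic-0 (y i) (binary i))) (ℚ.*-zeroʳ (weights i))

  lattice-point-on-or-outside : ∀ y → 4 ℕ.* s ℕ.≤ suc n → InV n s y →
    IsJVertex n s y ⊎ radius s < qns n s (y ⊖ vns n s)
  lattice-point-on-or-outside y 4s≤n+1 (int , Σy≡s) with Fin.all? (λ i → binary? (y i))
  ... | yes binary = inj₁ (binary , Σy≡s)
  ... | no ¬binary with Fin.¬∀⟶∃¬ (suc n) _ (λ i → binary? (y i)) ¬binary
  ... | j , ¬binary-j = inj₂ (begin-strict
    radius s                     ≡⟨ sym (ℚ.+-identityʳ (radius s)) ⟩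
    radius s + 0ℚ                <⟨ ℚ.+-monoʳ-< (radius s) (sumFin-pos (suc n) excess-nonneg j excess-pos) ⟩
    radius s + latticeExcess y   ≡⟨ sym (qns-around-vns y 4s≤n+1 Σy≡s) ⟩
    qns n s (y ⊖ vns n s)        ∎)
    where
    open ℚ.≤-Reasoning
    excess-nonneg : ∀ i → 0ℚ ≤ weights i * (y i * (y i - 1ℚ))
    excess-nonneg i = *-nonneg (ℚ.<⇒≤ (weightAt-pos s (toℕ i))) (pronic-nonneg (y i) (int i))
    excess-pos : 0ℚ < weights j * (y j * (y j - 1ℚ))
    excess-pos with binary⊎pronic-pos (y j) (int j)
    ... | inj₁ binary-j = contradiction binary-j ¬binary-j
    ... | inj₂ 0<pronic = *-pos (weightAt-pos s (toℕ j)) 0<pronic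

  reflect-vns-sum : ∀ x → 4 ℕ.* s ℕ.≤ suc n → sumPt n x ≡ ℕ→ℚ s → sumPt n (reflectThrough (vns n s) x) ≡ ℕ→ℚ s
  reflect-vns-sum x 4s≤n+1 Σx≡s = begin
    sumPt n (reflectThrough (vns n s) x)        ≡⟨ sum-reflectThrough (vns n s) x ⟩
    ℕ→ℚ 2 * sumPt n (vns n s) - sumPt n x       ≡⟨ cong₂ (λ a b → ℕ→ℚ 2 * a - b) (vns-sum 4s≤n+1) Σx≡s ⟩
    ℕ→ℚ 2 * ℕ→ℚ s - ℕ→ℚ s                       ≡⟨ solve 1 (λ σ → con (ℕ→ℚ 2) :* σ :- σ := σ) refl (ℕ→ℚ s) ⟩
    ℕ→ℚ s                                       ∎
    where open ≡-Reasoning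

  vns-block : ∀ i → vns n s i ≡ vBlock (block s (toℕ i))
  vns-block i = if-<4s⇒byBlock ¼ 0ℚ (blockBits s (toℕ i))

  tns-block : ∀ i → tns n s i ≡ tBlock (block s (toℕ i))
  tns-block i = if-<2s-<4s⇒byBlock ½ (- ½) 0ℚ (blockBits s (toℕ i))

  tns-sum : 4 ℕ.* s ℕ.≤ n → sumPt n (tns n s) ≡ 0ℚ
  tns-sum 4s≤n = begin
    sumPt n (tns n s)                                     ≡⟨ sumFin-cong (suc n) tns-block ⟩
    sumPt n (λ i → tBlock (block s (toℕ i)))              ≡⟨ sumPt-block n s 4s≤n tBlock ⟩
    (σ₂ * (½ + - ½) + 0ℚ) + μ * 0ℚ                        ≡⟨ solve 2 (λ σ μ → (σ :* (con ½ :+ con (- ½)) :+ con 0ℚ) :+ μ :* con 0ℚ := con 0ℚ) refl σ₂ μ ⟩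
    0ℚ                                                    ∎
    where
    open ≡-Reasoning
    σ₂ = ℕ→ℚ (2 ℕ.* s)
    μ = ℕ→ℚ (n ℕ.∸ 4 ℕ.* s)

  reflect-minus-tns-integral : ∀ i → IsInt (ℕ→ℚ 2 * vns n s i - tns n s i)
  reflect-minus-tns-integral i =
    subst₂ (λ v t → IsInt (ℕ→ℚ 2 * v - t)) (sym (vns-block i)) (sym (tns-block i)) (onBlock (block s (toℕ i)))
    where
    onBlock : ∀ β → IsInt (ℕ→ℚ 2 * vBlock β - tBlock β)
    onBlock first  = refl
    onBlock second = refl
    onBlock pivot  = refl
    onBlock tail   = refl

  -- 2 v_{n,s} - t_{n,s} is integral, so reflection through v_{n,s} exchanges V_{n,s} and t_{n,s} + V_{n,s}.
  module _ (4s≤n : 4 ℕ.* s ℕ.≤ n) (x : Pt n) where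

    private
      v = vns n s
      t = tns n s
      Σ[x⊖t] : sumPt n (x ⊖ t) ≡ sumPt n x
      Σ[x⊖t] = begin
        sumPt n (x ⊖ t)           ≡⟨ sumFin-- (suc n) x t ⟩
        sumPt n x - sumPt n t     ≡⟨ cong (λ u → sumPt n x - u) (tns-sum 4s≤n) ⟩
        sumPt n x - 0ℚ            ≡⟨ solve 1 (λ a → a :- con 0ℚ := a) refl (sumPt n x) ⟩
        sumPt n x                 ∎
        where open ≡-Reasoning

    reflect-V⇒t+V : InV n s (reflectThrough (vns n s) x) → InV n s (x ⊖ tns n s)
    reflect-V⇒t+V (int , Σ≡s) =
      (λ i → subst IsInt (x⊖t≡ i) (IsInt-- (ℕ→ℚ 2 * v i - t i) (reflectThrough v x i) (reflect-minus-tns-integral i) (int i))) ,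
      trans Σ[x⊖t] (trans (sym (sumFin-cong (suc n) (reflectThrough-involutive v x))) (reflect-vns-sum (reflectThrough v x) (ℕ.m≤n⇒m≤1+n 4s≤n) Σ≡s))
      where
      x⊖t≡ : ∀ i → (ℕ→ℚ 2 * v i - t i) - reflectThrough v x i ≡ x i - t i
      x⊖t≡ i = solve 3 (λ v t x → (con (ℕ→ℚ 2) :* v :- t) :- (con (ℕ→ℚ 2) :* v :- x) := x :- t) refl (v i) (t i) (x i)

    t+V⇒reflect-V : InV n s (x ⊖ tns n s) → InV n s (reflectThrough (vns n s) x)
    t+V⇒reflect-V (int , Σ≡s) =
      (λ i → subst IsInt (reflect≡ i) (IsInt-- (ℕ→ℚ 2 * v i - t i) (x i - t i) (reflect-minus-tns-integral i) (int i))) ,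
      reflect-vns-sum x (ℕ.m≤n⇒m≤1+n 4s≤n) (trans (sym Σ[x⊖t]) Σ≡s)
      where
      reflect≡ : ∀ i → (ℕ→ℚ 2 * v i - t i) - (x i - t i) ≡ reflectThrough v x i
      reflect≡ i = solve 3 (λ v t x → (con (ℕ→ℚ 2) :* v :- t) :- (x :- t) := con (ℕ→ℚ 2) :* v :- x) refl (v i) (t i) (x i)

  GenP-on-sphere : ∀ x → 4 ℕ.* s ℕ.≤ suc n → GenP n s x → qns n s (x ⊖ vns n s) ≡ radius s
  GenP-on-sphere x 4s≤n+1 (inj₁ J) = JVertex-on-sphere x 4s≤n+1 J
  GenP-on-sphere x 4s≤n+1 (inj₂ J) =
    trans (sym (diagForm-reflectThrough weights (vns n s) x)) (JVertex-on-sphere (reflectThrough (vns n s) x) 4s≤n+1 J)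

  GenP⇒IsVertexP : ∀ x → 4 ℕ.* s ℕ.≤ suc n → GenP n s x → IsVertexP n s x
  GenP⇒IsVertexP x 4s≤n+1 gen = gen ,
    sphere-point-extreme weights (λ i → weightAt-pos s (toℕ i)) {S = GenP n s} (vns n s) x (radius s)
      (λ p → GenP-on-sphere p 4s≤n+1) (GenP-on-sphere x 4s≤n+1 gen)

  GenP⇒InV4 : ∀ x → 4 ℕ.* s ℕ.≤ n → GenP n s x → InV4 n s x
  GenP⇒InV4 x 4s≤n (inj₁ J) = inj₁ (inj₁ (JVertex⇒InV n s x J))
  GenP⇒InV4 x 4s≤n (inj₂ J) = inj₁ (inj₂ (reflect-V⇒t+V 4s≤n x (JVertex⇒InV n s (reflectThrough (vns n s) x) J)))

  V2-non-vertex-outside : ∀ x → 4 ℕ.* s ℕ.≤ n → InV2 n s x → ¬ IsVertexP n s x →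
    radius s < qns n s (x ⊖ vns n s)
  V2-non-vertex-outside x 4s≤n (inj₁ x∈V) ¬vertex =
    [ (λ J → contradiction (GenP⇒IsVertexP x 4s≤n+1 (inj₁ J)) ¬vertex) , id ]′
      (lattice-point-on-or-outside x 4s≤n+1 x∈V)
    where 4s≤n+1 = ℕ.m≤n⇒m≤1+n 4s≤n
  V2-non-vertex-outside x 4s≤n (inj₂ x∈t+V) ¬vertex =
    [ (λ J → contradiction (GenP⇒IsVertexP x 4s≤n+1 (inj₂ J)) ¬vertex)
    , subst (radius s <_) (diagForm-reflectThrough weights (vns n s) x) ]′
      (lattice-point-on-or-outside (reflectThrough (vns n s) x) 4s≤n+1 (t+V⇒reflect-V 4s≤n x x∈t+V))
    where 4s≤n+1 = ℕ.m≤n⇒m≤1+n 4s≤n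

  weightAt-block : ∀ (i : Fin (suc n)) → weightAt s (toℕ i) ≡ weightBlock (block s (toℕ i))
  weightAt-block i = if-<4s⇒byBlock (ℕ→ℚ 2) 1ℚ (blockBits s (toℕ i))

  w+V2⇒coset : ∀ x → InV2 n s (x ⊖ wns n s) →
    Σ Bool λ shifted → ∀ i → IsInt (x i - cosetRep (isOdd n) shifted (block s (toℕ i)))
  w+V2⇒coset x (inj₁ (int , _)) = false , λ i →
    subst IsInt (unshift i) (IsInt-- (x i - wns n s i) (wShift n s * e1 n i) (int i) (IsInt-wShift*e1 n s i))
    where
    unshift : ∀ i → (x i - wns n s i) - wShift n s * e1 n i ≡ x i - cosetRep (isOdd n) false (block s (toℕ i))
    unshift i = trans (cong (λ w → (x i - w) - wShift n s * e1 n i) (wns-block n s i))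
      (solve 3 (λ x β k → (x :- (β :- k)) :- k := x :- (β :+ con 0ℚ)) refl
        (x i) (wBlock (isOdd n) (block s (toℕ i))) (wShift n s * e1 n i))
  w+V2⇒coset x (inj₂ (int , _)) = true , λ i →
    subst IsInt (unshift i) (IsInt-- ((x i - wns n s i) - tns n s i) (wShift n s * e1 n i) (int i) (IsInt-wShift*e1 n s i))
    where
    unshift : ∀ i → ((x i - wns n s i) - tns n s i) - wShift n s * e1 n i ≡ x i - cosetRep (isOdd n) true (block s (toℕ i))
    unshift i = trans (cong₂ (λ w t → ((x i - w) - t) - wShift n s * e1 n i) (wns-block n s i) (tns-block i))
      (solve 4 (λ x β τ k → ((x :- (β :- k)) :- τ) :- k := x :- (β :+ τ)) refl
        (x i) (wBlock (isOdd n) (block s (toℕ i))) (tBlock (block s (toℕ i))) (wShift n s * e1 n i))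

  coset-outside : ∀ x shifted → 4 ℕ.* s ℕ.≤ n → 6 ℕ.* s ℕ.< evenOf n →
    (∀ i → IsInt (x i - cosetRep (isOdd n) shifted (block s (toℕ i)))) → radius s < qns n s (x ⊖ vns n s)
  coset-outside x shifted 4s≤n 6s<N coset = begin-strict
    radius s                                                        <⟨ ℚ.*-monoˡ-<-pos ¼ (ℕ→ℚ-mono-< 6s<N) ⟩
    ℕ→ℚ (evenOf n) * ¼                                              ≡⟨ sym (cosetBound-sum n s (isOdd n) shifted 4s≤n) ⟩
    sumPt n (λ i → cosetBound (isOdd n) shifted (block s (toℕ i)))  ≤⟨ sumFin-mono-≤ (suc n) bound ⟩
    qns n s (x ⊖ vns n s)                                           ∎
    where
    open ℚ.≤-Reasoning
    bound : ∀ i → cosetBound (isOdd n) shifted (block s (toℕ i)) ≤ weights i * ((x i - vns n s i) * (x i - vns n s i))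
    bound i = subst₂ (λ w c → cosetBound (isOdd n) shifted β ≤ w * ((x i - c) * (x i - c)))
                (sym (weightAt-block i)) (sym (vns-block i))
                (weighted-coset-bound (cosetParity (isOdd n) shifted β) (x i) (weightBlock-nonneg β)
                  (coset-residue (isOdd n) shifted β) (coset i))
      where β = block s (toℕ i)

  InV4-non-vertex-outside : ∀ x → 4 ℕ.* s ℕ.≤ n → 6 ℕ.* s ℕ.< evenOf n → InV4 n s x → ¬ IsVertexP n s x →
    radius s < qns n s (x ⊖ vns n s)
  InV4-non-vertex-outside x 4s≤n 6s<N (inj₁ x∈V2) ¬vertex = V2-non-vertex-outside x 4s≤n x∈V2 ¬vertex
  InV4-non-vertex-outside x 4s≤n 6s<N (inj₂ x∈w+V2) _ =
    coset-outside x (proj₁ coset) 4s≤n 6s<N (proj₂ coset)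
    where coset = w+V2⇒coset x x∈w+V2

theorem4 : (n s : ℕ) → 1 ℕ.≤ s → 4 ℕ.* s ℕ.≤ suc n →
    (isOdd n ≡ true → 6 ℕ.* s ℕ.< suc n) →
    (isOdd n ≡ false → 6 ℕ.* s ℕ.< n) →
    IsDelaunayV4 n s (IsVertexP n s) (qns n s)
theorem4 n s 1≤s 4s≤n+1 odd-bound even-bound =
  (λ x vertex → GenP⇒InV4 n s x 4s≤n (proj₁ vertex)) ,
  vns n s , radius s , vns-sum n s 4s≤n+1 , radius-pos 1≤s ,
  (λ x vertex → GenP-on-sphere n s x 4s≤n+1 (proj₁ vertex)) ,
  (λ x x∈V4 ¬vertex → InV4-non-vertex-outside n s x 4s≤n 6s<N x∈V4 ¬vertex)
  where
  6s<N : 6 ℕ.* s ℕ.< evenOf n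
  6s<N with isOdd n
  ... | true  = odd-bound refl
  ... | false = even-bound refl
  4s≤n : 4 ℕ.* s ℕ.≤ n
  4s≤n = ℕ.≤-pred (ℕ.≤-trans (ℕ.s≤s (ℕ.*-monoˡ-≤ s {4} {6} (ℕ.s≤s (ℕ.s≤s (ℕ.s≤s (ℕ.s≤s ℕ.z≤n))))))
                             (ℕ.≤-trans 6s<N (evenOf≤1+n n)))
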